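{- Let $G$ be an undirected graph with $n$ vertices and let $I:=(G'=(V(G),\emptyset,E(G)),n)$, i.e., the instance of \textsc{Unweighted Flexible Graph Connectivity} in which all edges of $G$ are unsafe and $k=n$. Then $G$ contains a Hamiltonian cycle if and only if $I$ is a yes-instance of \textsc{Unweighted Flexible Graph Connectivity}.
   Context: A graph $G=(V,S,U)$ is an undirected graph on vertex set $V$ whose edge set $S\cup U$ is partitioned into safe edges $S$ and unsafe edges $U$. An edge set $T\subseteq S\cup U$ is an unsafe spanning connected subgraph of $G$ if $(V,T)$ is connected and, for every unsafe edge $e\in T\cap U$, $(V,T\setminus\{e\})$ is connected. \textsc{Unweighted Flexible Graph Connectivity}: given $G=(V,S,U)$ and an integer $k$, decide whether $G$ has an unsafe spanning connected subgraph $T$ with $|T|\le k$. -}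

module Defs where

open import Data.Nat using (ℕ; zero; suc; _≤_; _<_)
open import Data.Fin using (Fin; toℕ; suc)
open import Data.Fin as F using ()
open import Data.Bool using (Bool; true; false; T)
open import Data.Product using (Σ; _×_; _,_; ∃-syntax)
open import Data.List using (List; []; _∷_; length; filter; concatMap; allFin)
open import Relation.Binary.PropositionalEquality using (_≡_; _≢_)
open import Relation.Nullary using (¬_)
open import Function.Definitions using (Injective)
open import Data.Bool.Properties using (T?)

record Graph (n : ℕ) : Set where
  field
    adj   : Fin n → Fin n → Bool
    sym   : ∀ u v → adj u v ≡ adj v u
    irrefl : ∀ u → adj u u ≡ false
open Graph public

-- Edges are unordered pairs {u,v}, represented canonically by (u , v) with u < v.
-- A set of edges is a predicate on Fin n × Fin n; only canonical pairs u < v matter.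
EdgeSet : ℕ → Set
EdgeSet n = Fin n → Fin n → Bool

AdjIn : ∀ {n} → EdgeSet n → Fin n → Fin n → Set
AdjIn X u v = (u F.< v × T (X u v)) Data.Sum.⊎ (v F.< u × T (X v u))
  where import Data.Sum

EdgeOf : ∀ {n} → Graph n → Fin n → Fin n → Set
EdgeOf G u v = u F.< v × T (adj G u v)

_⊆E_ : ∀ {n} → EdgeSet n → Graph n → Set
X ⊆E G = ∀ u v → u F.< v → T (X u v) → T (adj G u v)

-- Remove the edge {a,b} (given canonically, a < b) from X.
remove : ∀ {n} → EdgeSet n → Fin n → Fin n → EdgeSet n
remove X a b u v with u F.≟ a | v F.≟ b
... | Relation.Nullary.yes _ | Relation.Nullary.yes _ = false
... | _ | _ = X u v

data Walk {n : ℕ} (X : EdgeSet n) : Fin n → Fin n → Set where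
  here : ∀ {u} → Walk X u u
  step : ∀ {u w v} → AdjIn X u w → Walk X w v → Walk X u v

Connected : ∀ {n} → EdgeSet n → Set
Connected {n} X = ∀ (u v : Fin n) → Walk X u v

allPairs : (n : ℕ) → List (Fin n × Fin n)
allPairs n = concatMap (λ u → concatMap (λ v → (u , v) ∷ []) (allFin n)) (allFin n)

size : ∀ {n} → EdgeSet n → ℕ
size {n} X = length (filter (λ p → T? (lt p Data.Bool.∧ X (Data.Product.proj₁ p) (Data.Product.proj₂ p))) (allPairs n))
  where
  import Data.Product
  lt : Fin n × Fin n → Bool
  lt (u , v) = Relation.Nullary.Decidable.⌊ u F.<? v ⌋
    where import Relation.Nullary.Decidable

record FGCInstance (n : ℕ) : Set where
  field
    safe   : Fin n → Fin n → Bool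
    unsafe : Fin n → Fin n → Bool
    k      : ℕ

IsUnsafeSpanningConnectedSubgraph : ∀ {n} → FGCInstance n → EdgeSet n → Set
IsUnsafeSpanningConnectedSubgraph {n} I X =
  (∀ u v → u F.< v → T (X u v) → T (FGCInstance.safe I u v) Data.Sum.⊎ T (FGCInstance.unsafe I u v))
  × Connected X
  × (∀ u v → u F.< v → T (X u v) → T (FGCInstance.unsafe I u v) → Connected (remove X u v))
  where import Data.Sum

YesInstance : ∀ {n} → FGCInstance n → Set
YesInstance {n} I = Σ (EdgeSet n) λ X → IsUnsafeSpanningConnectedSubgraph I X × size X ≤ FGCInstance.k I

allEdgesUnsafeInstance : ∀ {n} → Graph n → FGCInstance n
allEdgesUnsafeInstance {n} G = record { safe = λ _ _ → false ; unsafe = adj G ; k = n }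

-- Hamiltonian cycle: a cyclic ordering σ of all vertices (bijection Fin n → Fin n)
-- with σ i adjacent to σ (i+1 mod n) for every i.  (Meaningful as a cycle for n ≥ 3.)
next : ∀ {n} → Fin n → Fin n
next {suc m} i = suc (toℕ i) mod suc m
  where open import Data.Nat.DivMod using (_mod_)

HamiltonianCycle : ∀ {n} → Graph n → Set
HamiltonianCycle {n} G =
  Σ (Fin n → Fin n) λ σ → Injective _≡_ _≡_ σ × (∀ i → T (adj G (σ i) (σ (next i))))

{-# OPTIONS --safe #-}
module Submission where

-- A Hamiltonian cycle, viewed as an edge set, is connected, stays connected after deleting
-- any one of its edges (for n ≥ 3), and has n edges.  Conversely, let T be a spanning
-- subgraph with at most n edges that stays connected after deleting any edge.  Then every
-- vertex has two distinct neighbours in T, and since the degrees sum to 2|T| ≤ 2n, it has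
-- exactly two.  Following T from a vertex without ever turning back, the first vertex to be
-- revisited is the starting one; the closed walk obtained is closed under taking neighbours,
-- so by connectedness it passes through all n vertices: it is a Hamiltonian cycle.

open import Defs renaming (sym to adj-sym; irrefl to adj-irrefl)
open import Data.Nat
  using (ℕ; zero; suc; _+_; _*_; _%_; _≤_; _<_; _≤′_; ≤′-reflexive; ≤′-step; z≤n; s≤s)
import Data.Nat.Properties as ℕₚ
open import Data.Fin as Fin using (Fin; toℕ; fromℕ<; punchIn; punchOut)
import Data.Fin.Properties as Finₚ
open import Data.Nat.DivMod using (_mod_; n%n≡0; m<n⇒m%n≡m)
open import Data.Bool using (Bool; true; false; T; _∧_; _∨_)
open import Data.Bool.Properties using (T?; T-∧; T-∨; ∨-comm)
open import Data.Product using (∃; ∃₂; _×_; _,_; proj₁; proj₂)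
import Data.Product as Product
open import Data.Sum using (_⊎_; inj₁; inj₂)
import Data.Sum as Sum
open import Data.Empty using (⊥; ⊥-elim)
open import Data.List using (List; []; _∷_; length; filter; concatMap; tabulate; allFin; _++_)
open import Data.List.Properties using (length-++; filter-++)
open import Data.Vec.Functional using (removeAt)
open import Function using (_∘_; id)
open import Function.Bundles using (_⇔_; mk⇔; Equivalence)
open import Function.Construct.Composition using (_⇔-∘_)
open import Function.Definitions using (Injective)
open import Relation.Binary.PropositionalEquality
open import Relation.Nullary using (¬_; yes; no; does; contradiction)
open import Relation.Binary using (tri<; tri≈; tri>)
open import Relation.Nullary.Decidable using (⌊_⌋; toWitness; fromWitness; ⌊⌋-map′)
open import Relation.Unary using (Pred; Decidable)
open import Level using (0ℓ)
open import Algebra.Properties.CommutativeMonoid.Sum ℕₚ.+-0-commutativeMonoid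
  using (sum; sum-syntax; sum-cong-≗; sum-replicate-zero; sum-remove; ∑-distrib-+; ∑-comm)

private
  variable
    n : ℕ

-- Finite sums of natural numbers

𝟙 : Bool → ℕ
𝟙 true = 1
𝟙 false = 0

T⇒1≤𝟙 : ∀ {b} → T b → 1 ≤ 𝟙 b
T⇒1≤𝟙 {true} _ = s≤s z≤n

𝟙-∧-split : ∀ l x h₁ h₂ → (T l → T x → T h₁ ⊎ T h₂) → 𝟙 (l ∧ x) ≤ 𝟙 (l ∧ h₁) + 𝟙 (l ∧ h₂)
𝟙-∧-split false x h₁ h₂ _ = z≤n
𝟙-∧-split true false h₁ h₂ _ = z≤n
𝟙-∧-split true true true h₂ _ = s≤s z≤n
𝟙-∧-split true true false true _ = s≤s z≤n
𝟙-∧-split true true false false hit with hit _ _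
... | inj₁ ()
... | inj₂ ()

𝟙-∧-exclusive : ∀ l₁ l₂ h → (T l₁ → ¬ T l₂) → 𝟙 (l₁ ∧ h) + 𝟙 (l₂ ∧ h) ≤ 𝟙 h
𝟙-∧-exclusive false false h _ = z≤n
𝟙-∧-exclusive false true h _ = ℕₚ.≤-refl
𝟙-∧-exclusive true false h _ = ℕₚ.≤-reflexive (ℕₚ.+-identityʳ (𝟙 h))
𝟙-∧-exclusive true true h excl = ⊥-elim (excl _ _)

∑-mono-≤ : {f g : Fin n → ℕ} → (∀ i → f i ≤ g i) → sum f ≤ sum g
∑-mono-≤ {zero} _ = z≤n
∑-mono-≤ {suc n} f≤g = ℕₚ.+-mono-≤ (f≤g Fin.zero) (∑-mono-≤ (f≤g ∘ Fin.suc))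

∑-const : ∀ n k → ∑[ i < n ] k ≡ n * k
∑-const zero k = refl
∑-const (suc n) k = cong (k +_) (∑-const n k)

f≤∑f : (f : Fin n → ℕ) (i : Fin n) → f i ≤ sum f
f≤∑f {suc n} f i = subst (f i ≤_) (sym (sum-remove f)) (ℕₚ.m≤m+n (f i) _)

removeAt-punchOut : ∀ (f : Fin (suc n) → ℕ) {i j} (i≢j : i ≢ j) → removeAt f i (punchOut i≢j) ≡ f j
removeAt-punchOut f i≢j = cong f (Finₚ.punchIn-punchOut i≢j)

fi+fj≤∑f : (f : Fin n → ℕ) {i j : Fin n} → i ≢ j → f i + f j ≤ sum f
fi+fj≤∑f {suc n} f {i} {j} i≢j = begin
  f i + f j                          ≡⟨ cong (f i +_) (removeAt-punchOut f i≢j) ⟨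
  f i + removeAt f i (punchOut i≢j)  ≤⟨ ℕₚ.+-monoʳ-≤ (f i) (f≤∑f (removeAt f i) _) ⟩
  f i + sum (removeAt f i)           ≡⟨ sum-remove f ⟨
  sum f                              ∎
  where open ℕₚ.≤-Reasoning

fi+fj+fk≤∑f : (f : Fin n → ℕ) {i j k : Fin n} → i ≢ j → i ≢ k → j ≢ k → f i + (f j + f k) ≤ sum f
fi+fj+fk≤∑f {suc n} f {i} {j} {k} i≢j i≢k j≢k = begin
  f i + (f j + f k)
    ≡⟨ cong₂ (λ a b → f i + (a + b)) (removeAt-punchOut f i≢j) (removeAt-punchOut f i≢k) ⟨
  f i + (f′ (punchOut i≢j) + f′ (punchOut i≢k))
    ≤⟨ ℕₚ.+-monoʳ-≤ (f i) (fi+fj≤∑f f′ (j≢k ∘ Finₚ.punchOut-injective i≢j i≢k)) ⟩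
  f i + sum f′                    ≡⟨ sum-remove f ⟨
  sum f                           ∎
  where
  open ℕₚ.≤-Reasoning
  f′ = removeAt f i

∑≤n*k⇒f≤k : ∀ {k} (f : Fin n → ℕ) → (∀ i → k ≤ f i) → sum f ≤ n * k → ∀ i → f i ≤ k
∑≤n*k⇒f≤k {suc n} {k} f k≤f ∑f≤ i = ℕₚ.+-cancelʳ-≤ (n * k) (f i) k (begin
  f i + n * k               ≡⟨ cong (f i +_) (∑-const n k) ⟨
  f i + ∑[ j < n ] k        ≤⟨ ℕₚ.+-monoʳ-≤ (f i) (∑-mono-≤ (k≤f ∘ punchIn i)) ⟩
  f i + sum (removeAt f i)  ≡⟨ sum-remove f ⟨
  sum f                     ≤⟨ ∑f≤ ⟩
  k + n * k                 ∎)
  where open ℕₚ.≤-Reasoning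

∑-𝟙-≟ : (a : Fin n) → ∑[ v < n ] 𝟙 ⌊ v Finₚ.≟ a ⌋ ≡ 1
∑-𝟙-≟ {suc n} Fin.zero = cong suc (sum-replicate-zero n)
∑-𝟙-≟ {suc n} (Fin.suc a) = trans (sum-cong-≗ λ v → cong 𝟙 (⌊⌋-map′ _ _ (v Finₚ.≟ a))) (∑-𝟙-≟ a)

-- Counting edges

count-concatMap : ∀ {A B : Set} {P : Pred A 0ℓ} (P? : Decidable P) (g : B → List A) (h : Fin n → B) →
  length (filter P? (concatMap g (tabulate h))) ≡ ∑[ i < n ] length (filter P? (g (h i)))
count-concatMap {zero} P? g h = refl
count-concatMap {suc n} P? g h = begin
  length (filter P? (g (h Fin.zero) ++ rest))                   ≡⟨ cong length (filter-++ P? (g (h Fin.zero)) rest) ⟩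
  length (filter P? (g (h Fin.zero)) ++ filter P? rest)         ≡⟨ length-++ (filter P? (g (h Fin.zero))) ⟩
  length (filter P? (g (h Fin.zero))) + length (filter P? rest) ≡⟨ cong (_ +_) (count-concatMap P? g (h ∘ Fin.suc)) ⟩
  ∑[ i < suc n ] length (filter P? (g (h i)))                   ∎
  where
  open ≡-Reasoning
  rest = concatMap g (tabulate (h ∘ Fin.suc))

count-singleton : ∀ {A : Set} {P : Pred A 0ℓ} (P? : Decidable P) x →
  length (filter P? (x ∷ [])) ≡ 𝟙 (does (P? x))
count-singleton P? x with does (P? x)
... | true = refl
... | false = refl

edgeCount : EdgeSet n → Fin n → Fin n → ℕ
edgeCount X u v = 𝟙 (⌊ u Fin.<? v ⌋ ∧ X u v)

size≡∑∑edgeCount : (X : EdgeSet n) → size X ≡ ∑[ u < n ] ∑[ v < n ] edgeCount X u v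
size≡∑∑edgeCount {n} X = trans (count-concatMap P? (λ u → concatMap (λ v → (u , v) ∷ []) (allFin n)) id)
  (sum-cong-≗ λ u → trans (count-concatMap P? (λ v → (u , v) ∷ []) id)
                          (sum-cong-≗ λ v → count-singleton P? (u , v)))
  where
  P? = λ (p : Fin n × Fin n) → T? (⌊ proj₁ p Fin.<? proj₂ p ⌋ ∧ X (proj₁ p) (proj₂ p))

degree : EdgeSet n → Fin n → ℕ
degree {n} X v = ∑[ u < n ] (edgeCount X v u + edgeCount X u v)

handshake : (X : EdgeSet n) → ∑[ v < n ] degree X v ≡ size X + size X
handshake {n} X = begin
  ∑[ v < n ] degree X v
    ≡⟨ sum-cong-≗ (λ v → ∑-distrib-+ (edgeCount X v) (λ u → edgeCount X u v)) ⟩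
  ∑[ v < n ] (∑[ u < n ] edgeCount X v u + ∑[ u < n ] edgeCount X u v)
    ≡⟨ ∑-distrib-+ (λ v → ∑[ u < n ] edgeCount X v u) (λ v → ∑[ u < n ] edgeCount X u v) ⟩
  ∑∑ + ∑[ v < n ] ∑[ u < n ] edgeCount X u v
    ≡⟨ cong (∑∑ +_) (∑-comm (edgeCount X)) ⟨
  ∑∑ + ∑∑
    ≡⟨ cong₂ _+_ (size≡∑∑edgeCount X) (size≡∑∑edgeCount X) ⟨
  size X + size X ∎
  where
  open ≡-Reasoning
  ∑∑ = ∑[ u < n ] ∑[ v < n ] edgeCount X u v

adjIn⇒1≤edgeCount : (X : EdgeSet n) {v u : Fin n} → AdjIn X v u → 1 ≤ edgeCount X v u + edgeCount X u v
adjIn⇒1≤edgeCount X {v} {u} (inj₁ (v<u , t)) =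
  ℕₚ.≤-trans (T⇒1≤𝟙 (Equivalence.from T-∧ (fromWitness v<u , t))) (ℕₚ.m≤m+n _ (edgeCount X u v))
adjIn⇒1≤edgeCount X {v} {u} (inj₂ (u<v , t)) =
  ℕₚ.≤-trans (T⇒1≤𝟙 (Equivalence.from T-∧ (fromWitness u<v , t))) (ℕₚ.m≤n+m _ (edgeCount X v u))

-- Charging every edge {u, s u} to u counts each vertex at most once.
successorEdges⇒size≤n : (s : Fin n → Fin n) (X : EdgeSet n) →
  (∀ u v → u Fin.< v → T (X u v) → v ≡ s u ⊎ u ≡ s v) → size X ≤ n
successorEdges⇒size≤n {n} s X along = begin
  size X                                  ≡⟨ size≡∑∑edgeCount X ⟩
  ∑∑ (edgeCount X)
    ≤⟨ ∑∑-mono (λ u v → 𝟙-∧-split _ (X u v) (hit u v) (hit v u) (along′ u v)) ⟩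
  ∑∑ (λ u v → fwd u v + bwd v u)          ≡⟨ ∑∑-distrib fwd (λ u v → bwd v u) ⟩
  ∑∑ fwd + ∑∑ (λ u v → bwd v u)           ≡⟨ cong (∑∑ fwd +_) (∑-comm bwd) ⟨
  ∑∑ fwd + ∑∑ bwd                         ≡⟨ ∑∑-distrib fwd bwd ⟨
  ∑∑ (λ u v → fwd u v + bwd u v)
    ≤⟨ ∑∑-mono (λ u v → 𝟙-∧-exclusive _ _ (hit u v) (exclusive u v)) ⟩
  ∑∑ (λ u v → 𝟙 (hit u v))                ≡⟨ sum-cong-≗ (∑-𝟙-≟ ∘ s) ⟩
  ∑[ u < n ] 1                            ≡⟨ ∑-const n 1 ⟩
  n * 1                                   ≡⟨ ℕₚ.*-identityʳ n ⟩
  n                                       ∎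
  where
  open ℕₚ.≤-Reasoning
  ∑∑ : (Fin n → Fin n → ℕ) → ℕ
  ∑∑ f = ∑[ u < n ] ∑[ v < n ] f u v
  ∑∑-mono : {f g : Fin n → Fin n → ℕ} → (∀ u v → f u v ≤ g u v) → ∑∑ f ≤ ∑∑ g
  ∑∑-mono f≤g = ∑-mono-≤ (∑-mono-≤ ∘ f≤g)
  ∑∑-distrib : (f g : Fin n → Fin n → ℕ) → ∑∑ (λ u v → f u v + g u v) ≡ ∑∑ f + ∑∑ g
  ∑∑-distrib f g =
    trans (sum-cong-≗ λ u → ∑-distrib-+ (f u) (g u)) (∑-distrib-+ (λ u → ∑[ v < n ] f u v) _)
  hit : Fin n → Fin n → Bool
  hit u v = ⌊ v Finₚ.≟ s u ⌋
  fwd bwd : Fin n → Fin n → ℕ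
  fwd u v = 𝟙 (⌊ u Fin.<? v ⌋ ∧ hit u v)
  bwd u v = 𝟙 (⌊ v Fin.<? u ⌋ ∧ hit u v)
  along′ : ∀ u v → T ⌊ u Fin.<? v ⌋ → T (X u v) → T (hit u v) ⊎ T (hit v u)
  along′ u v u<v uv∈X = Sum.map fromWitness fromWitness (along u v (toWitness u<v) uv∈X)
  exclusive : ∀ u v → T ⌊ u Fin.<? v ⌋ → ¬ T ⌊ v Fin.<? u ⌋
  exclusive u v u<v v<u = Finₚ.<-asym (toWitness u<v) (toWitness v<u)

-- Walks and edge removal

_≐_ : {A : Set} → A × A → A × A → Set
(p , q) ≐ (r , s) = (p ≡ r × q ≡ s) ⊎ (p ≡ s × q ≡ r)

≐-trans : {A : Set} {a b c d e f : A} → (a , b) ≐ (c , d) → (c , d) ≐ (e , f) → (a , b) ≐ (e , f)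
≐-trans (inj₁ (refl , refl)) cd≐ef = cd≐ef
≐-trans (inj₂ (refl , refl)) (inj₁ (refl , refl)) = inj₂ (refl , refl)
≐-trans (inj₂ (refl , refl)) (inj₂ (refl , refl)) = inj₁ (refl , refl)

Bridgeless : EdgeSet n → Set
Bridgeless X = ∀ u v → u Fin.< v → T (X u v) → Connected (remove X u v)

module _ {X : EdgeSet n} where

  adjIn-sym : ∀ {u v} → AdjIn X u v → AdjIn X v u
  adjIn-sym = Sum.swap

  adjIn-irrefl : ∀ {u v} → AdjIn X u v → u ≢ v
  adjIn-irrefl (inj₁ (u<v , _)) refl = Finₚ.<-irrefl refl u<v
  adjIn-irrefl (inj₂ (v<u , _)) refl = Finₚ.<-irrefl refl v<u

  adjIn-intro : (∀ {u v} → T (X u v) → T (X v u)) → ∀ {u v} → u ≢ v → T (X u v) → AdjIn X u v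
  adjIn-intro X-sym {u} {v} u≢v uv∈X with Finₚ.<-cmp u v
  ... | tri< u<v _ _ = inj₁ (u<v , uv∈X)
  ... | tri≈ _ u≡v _ = contradiction u≡v u≢v
  ... | tri> _ _ v<u = inj₂ (v<u , X-sym uv∈X)

  walk-++ : ∀ {u v w} → Walk X u v → Walk X v w → Walk X u w
  walk-++ here q = q
  walk-++ (step a p) q = step a (walk-++ p q)

  walk-reverse : ∀ {u v} → Walk X u v → Walk X v u
  walk-reverse here = here
  walk-reverse (step a p) = walk-++ (walk-reverse p) (step (adjIn-sym a) here)

  first-step : ∀ {u v} → u ≢ v → Walk X u v → ∃ (AdjIn X u)
  first-step u≢u here = contradiction refl u≢u
  first-step _ (step a _) = _ , a

  walk-along : (f : ℕ → Fin n) {i j : ℕ} → i ≤′ j →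
    (∀ {c} → i ≤ c → c < j → AdjIn X (f c) (f (suc c))) → Walk X (f i) (f j)
  walk-along f (≤′-reflexive refl) _ = here
  walk-along f (≤′-step i≤′j) edge =
    walk-++ (walk-along f i≤′j (λ i≤c c<j → edge i≤c (ℕₚ.m<n⇒m<1+n c<j)))
            (step (edge (ℕₚ.≤′⇒≤ i≤′j) (ℕₚ.n<1+n _)) here)

  connected-invariant : Connected X → (P : Fin n → Set) → (∀ {u v} → AdjIn X u v → P u → P v) →
    ∀ {u} → P u → ∀ v → P v
  connected-invariant connected P preserved {u} Pu v = along (connected u v) Pu
    where
    along : ∀ {u v} → Walk X u v → P u → P v
    along here Pu = Pu
    along (step a p) Pu = along p (preserved a Pu)

module _ (X : EdgeSet n) (a b : Fin n) where

  remove-⊆ : ∀ {u v} → T (remove X a b u v) → T (X u v)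
  remove-⊆ {u} {v} uv∈ with u Fin.≟ a | v Fin.≟ b
  ... | yes _ | yes _ = ⊥-elim uv∈
  ... | yes _ | no _ = uv∈
  ... | no _  | _    = uv∈

  remove-keeps : ∀ {u v} → ¬ (u ≡ a × v ≡ b) → T (X u v) → T (remove X a b u v)
  remove-keeps {u} {v} ≢ab uv∈X with u Fin.≟ a | v Fin.≟ b
  ... | yes u≡a | yes v≡b = contradiction (u≡a , v≡b) ≢ab
  ... | yes _   | no _    = uv∈X
  ... | no _    | _       = uv∈X

  remove-removes : a Fin.< b → ¬ AdjIn (remove X a b) a b
  remove-removes _ (inj₁ (_ , ab∈)) with a Fin.≟ a | b Fin.≟ b
  ... | yes _   | yes _   = ab∈
  ... | no a≢a  | _       = a≢a refl
  ... | yes _   | no b≢b  = b≢b refl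
  remove-removes a<b (inj₂ (b<a , _)) = Finₚ.<-asym a<b b<a

  adjIn-remove⁻ : ∀ {u v} → AdjIn (remove X a b) u v → AdjIn X u v
  adjIn-remove⁻ (inj₁ (u<v , uv∈)) = inj₁ (u<v , remove-⊆ uv∈)
  adjIn-remove⁻ (inj₂ (v<u , vu∈)) = inj₂ (v<u , remove-⊆ vu∈)

  adjIn-remove⁺ : ∀ {u v} → AdjIn X u v → ¬ (u , v) ≐ (a , b) → AdjIn (remove X a b) u v
  adjIn-remove⁺ (inj₁ (u<v , uv∈X)) ≢ab = inj₁ (u<v , remove-keeps (≢ab ∘ inj₁) uv∈X)
  adjIn-remove⁺ (inj₂ (v<u , vu∈X)) ≢ab = inj₂ (v<u , remove-keeps (≢ab ∘ inj₂ ∘ Product.swap) vu∈X)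

-- Hamiltonian cycles as closed walks

injective⇒surjective : {f : Fin n → Fin n} → Injective _≡_ _≡_ f → ∀ w → ∃ λ i → f i ≡ w
injective⇒surjective {suc n} {f} f-injective w with Finₚ.any? (λ i → f i Finₚ.≟ w)
... | yes hit = hit
... | no miss = contradiction (Finₚ.injective⇒≤ squeezed-injective) ℕₚ.1+n≰n
  where
  f≢w : ∀ i → w ≢ f i
  f≢w i w≡fi = miss (i , sym w≡fi)
  squeezed-injective : Injective _≡_ _≡_ (λ i → punchOut (f≢w i))
  squeezed-injective = f-injective ∘ Finₚ.punchOut-injective (f≢w _) (f≢w _)

-- Positions on the cycle are natural numbers rather than elements of Fin n, so that
-- walking along the cycle needs no arithmetic modulo n.
InjectiveBelow : {A : Set} → (ℕ → A) → ℕ → Set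
InjectiveBelow f k = ∀ {a b} → a < k → b < k → f a ≡ f b → a ≡ b

injectiveBelow⇒surjective : {f : ℕ → Fin n} → InjectiveBelow f n → ∀ w → ∃ λ j → j < n × f j ≡ w
injectiveBelow⇒surjective {f = f} injective w
  with injective⇒surjective {f = f ∘ toℕ} (Finₚ.toℕ-injective ∘ injective (Finₚ.toℕ<n _) (Finₚ.toℕ<n _)) w
... | i , hit = toℕ i , Finₚ.toℕ<n i , hit

record HamiltonianClosedWalk {n} (_~_ : Fin n → Fin n → Set) : Set where
  field
    vertex   : ℕ → Fin n
    adjacent : ∀ {c} → c < n → vertex c ~ vertex (suc c)
    distinct : InjectiveBelow vertex n
    closed   : vertex n ≡ vertex 0

  covers : ∀ w → ∃ λ j → j < n × vertex j ≡ w
  covers = injectiveBelow⇒surjective distinct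

  connected-avoiding : {Y : EdgeSet n} (e : ℕ) →
    (∀ {c} → c < n → c ≢ e → AdjIn Y (vertex c) (vertex (suc c))) → Connected Y
  connected-avoiding {Y} e edge u v with covers u | covers v
  ... | i , i<n , refl | j , j<n , refl = walk-++ (to-start i<n) (walk-reverse (to-start j<n))
    where
    -- Go back to vertex 0 along the side of the cycle that does not contain position e.
    to-start : ∀ {j} → j < n → Walk Y (vertex j) (vertex 0)
    to-start {j} j<n with ℕₚ.≤-<-connex j e
    ... | inj₁ j≤e = walk-reverse (walk-along vertex (ℕₚ.≤⇒≤′ z≤n)
          (λ _ c<j → edge (ℕₚ.<-trans c<j j<n) λ { refl → ℕₚ.<-irrefl refl (ℕₚ.<-≤-trans c<j j≤e) }))
    ... | inj₂ e<j = subst (Walk Y (vertex j)) closed (walk-along vertex (ℕₚ.≤⇒≤′ (ℕₚ.<⇒≤ j<n))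
          (λ j≤c c<n → edge c<n λ { refl → ℕₚ.<-irrefl refl (ℕₚ.<-≤-trans e<j j≤c) }))

mapClosedWalk : ∀ {n} {R S : Fin n → Fin n → Set} → (∀ {u v} → R u v → S u v) →
  HamiltonianClosedWalk R → HamiltonianClosedWalk S
mapClosedWalk R⇒S W = record
  { vertex = vertex ; adjacent = R⇒S ∘ adjacent ; distinct = distinct ; closed = closed }
  where open HamiltonianClosedWalk W

Adj : Graph n → Fin n → Fin n → Set
Adj G u v = T (adj G u v)

adj-≢ : (G : Graph n) → ∀ {u v} → Adj G u v → u ≢ v
adj-≢ G {u} uv refl = subst T (adj-irrefl G u) uv

toℕ-mod : ∀ {c} → c < suc n → toℕ (c mod suc n) ≡ c
toℕ-mod c<n = trans (Finₚ.toℕ-fromℕ< _) (m<n⇒m%n≡m c<n)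

cycle⇔closedWalk : (G : Graph (suc n)) → HamiltonianCycle G ⇔ HamiltonianClosedWalk (Adj G)
cycle⇔closedWalk {n} G = mk⇔ toClosedWalk toCycle
  where
  toClosedWalk : HamiltonianCycle G → HamiltonianClosedWalk (Adj G)
  toClosedWalk (σ , σ-injective , σ-adjacent) = record
    { vertex   = λ c → σ (c mod suc n)
    ; adjacent = λ {c} c<n → subst (λ i → Adj G (σ (c mod suc n)) (σ (suc i mod suc n))) (toℕ-mod c<n)
                                   (σ-adjacent (c mod suc n))
    ; distinct = λ a<n b<n σa≡σb →
                   trans (sym (toℕ-mod a<n)) (trans (cong toℕ (σ-injective σa≡σb)) (toℕ-mod b<n))
    ; closed   = cong σ (Finₚ.toℕ-injective (trans (Finₚ.toℕ-fromℕ< _) (n%n≡0 (suc n))))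
    }

  toCycle : HamiltonianClosedWalk (Adj G) → HamiltonianCycle G
  toCycle W = vertex ∘ toℕ , Finₚ.toℕ-injective ∘ distinct (Finₚ.toℕ<n _) (Finₚ.toℕ<n _) ,
              λ i → subst (Adj G (vertex (toℕ i))) (sym (vertex-next i)) (adjacent (Finₚ.toℕ<n i))
    where
    open HamiltonianClosedWalk W
    vertex-next : ∀ i → vertex (toℕ (next i)) ≡ vertex (suc (toℕ i))
    vertex-next i with ℕₚ.m≤n⇒m<n∨m≡n (Finₚ.toℕ<n i)
    ... | inj₁ 1+i<n = cong vertex (toℕ-mod 1+i<n)
    ... | inj₂ 1+i≡n = begin
      vertex (toℕ (next i))
        ≡⟨ cong vertex (trans (Finₚ.toℕ-fromℕ< _) (trans (cong (_% suc n) 1+i≡n) (n%n≡0 (suc n)))) ⟩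
      vertex 0               ≡⟨ closed ⟨
      vertex (suc n)         ≡⟨ cong vertex 1+i≡n ⟨
      vertex (suc (toℕ i))   ∎
      where open ≡-Reasoning

-- From a Hamiltonian cycle to an unsafe spanning connected subgraph

module CycleEdges {n} (3≤n : 3 ≤ n) (G : Graph n) (W : HamiltonianClosedWalk (Adj G)) where

  open HamiltonianClosedWalk W

  0<n : 0 < n
  0<n = ℕₚ.<-≤-trans (s≤s z≤n) 3≤n

  1<n : 1 < n
  1<n = ℕₚ.<-≤-trans (s≤s (s≤s z≤n)) 3≤n

  n≢2 : n ≢ 2
  n≢2 n≡2 = ℕₚ.<-irrefl refl (subst (2 <_) n≡2 3≤n)

  position : Fin n → ℕ
  position = proj₁ ∘ covers

  position<n : ∀ w → position w < n
  position<n = proj₁ ∘ proj₂ ∘ covers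

  vertex-position : ∀ w → vertex (position w) ≡ w
  vertex-position = proj₂ ∘ proj₂ ∘ covers

  position-vertex : ∀ {c} → c < n → position (vertex c) ≡ c
  position-vertex c<n = distinct (position<n _) c<n (vertex-position _)

  successor : Fin n → Fin n
  successor w = vertex (suc (position w))

  adj-successor : ∀ u → Adj G u (successor u)
  adj-successor u = subst (λ w → Adj G w (successor u)) (vertex-position u) (adjacent (position<n u))

  cycleEdges : EdgeSet n
  cycleEdges u v = ⌊ v Finₚ.≟ successor u ⌋ ∨ ⌊ u Finₚ.≟ successor v ⌋

  cycleEdges-sym : ∀ {u v} → T (cycleEdges u v) → T (cycleEdges v u)
  cycleEdges-sym {u} {v} = subst T (∨-comm ⌊ v Finₚ.≟ successor u ⌋ ⌊ u Finₚ.≟ successor v ⌋)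

  cycleEdges-cases : ∀ {u v} → T (cycleEdges u v) → v ≡ successor u ⊎ u ≡ successor v
  cycleEdges-cases {u} {v} =
    Sum.map toWitness toWitness
    ∘ Equivalence.to (T-∨ {⌊ v Finₚ.≟ successor u ⌋} {⌊ u Finₚ.≟ successor v ⌋})

  cycleEdges⊆G : ∀ {u v} → T (cycleEdges u v) → Adj G u v
  cycleEdges⊆G {u} {v} uv∈ with cycleEdges-cases {u} {v} uv∈
  ... | inj₁ refl = adj-successor u
  ... | inj₂ refl = subst T (adj-sym G v (successor v)) (adj-successor v)

  cycle-adjIn : ∀ {c} → c < n → AdjIn cycleEdges (vertex c) (vertex (suc c))
  cycle-adjIn {c} c<n = adjIn-intro {X = cycleEdges} (λ {u} {v} → cycleEdges-sym {u} {v})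
    (adj-≢ G (adjacent c<n)) (Equivalence.from T-∨ (inj₁ succ-hit))
    where
    succ-hit : T ⌊ vertex (suc c) Finₚ.≟ successor (vertex c) ⌋
    succ-hit = fromWitness (cong (vertex ∘ suc) (sym (position-vertex c<n)))

  edge-position : ∀ {a b} → T (cycleEdges a b) → ∃ λ e → e < n × (a , b) ≐ (vertex e , vertex (suc e))
  edge-position {a} {b} ab∈ with cycleEdges-cases {a} {b} ab∈
  ... | inj₁ b≡sa = position a , position<n a , inj₁ (sym (vertex-position a) , b≡sa)
  ... | inj₂ a≡sb = position b , position<n b , inj₂ (a≡sb , sym (vertex-position b))

  -- Here n ≥ 3 is needed: on two vertices the cycle would traverse its only edge in both directions.
  no-reversed-edge : ∀ {c e} → c < n → e < n → vertex c ≡ vertex (suc e) → vertex (suc c) ≡ vertex e → ⊥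
  no-reversed-edge {c} {e} c<n e<n c≡1+e 1+c≡e with ℕₚ.m≤n⇒m<n∨m≡n e<n
  ... | inj₁ 1+e<n with distinct c<n 1+e<n c≡1+e
  ...   | refl with ℕₚ.m≤n⇒m<n∨m≡n 1+e<n
  ...     | inj₁ 2+e<n = ℕₚ.<⇒≢ (ℕₚ.m<n⇒m<1+n (ℕₚ.n<1+n e)) (sym (distinct 2+e<n e<n 1+c≡e))
  ...     | inj₂ 2+e≡n with distinct 0<n e<n (trans (sym closed) (trans (cong vertex (sym 2+e≡n)) 1+c≡e))
  ...       | refl = n≢2 (sym 2+e≡n)
  no-reversed-edge {c} {e} c<n e<n c≡1+e 1+c≡e | inj₂ 1+e≡n
    with distinct c<n 0<n (trans c≡1+e (trans (cong vertex 1+e≡n) closed))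
  ... | refl with distinct 1<n e<n 1+c≡e
  ...   | refl = n≢2 (sym 1+e≡n)

  cycle-edge-unique : ∀ {c e} → c < n → e < n →
    (vertex c , vertex (suc c)) ≐ (vertex e , vertex (suc e)) → c ≡ e
  cycle-edge-unique c<n e<n (inj₁ (c≡e , _)) = distinct c<n e<n c≡e
  cycle-edge-unique c<n e<n (inj₂ (c≡1+e , 1+c≡e)) = ⊥-elim (no-reversed-edge c<n e<n c≡1+e 1+c≡e)

  -- No cycle position equals n, so nothing is avoided.
  connected : Connected cycleEdges
  connected = connected-avoiding n (λ c<n _ → cycle-adjIn c<n)

  bridgeless : Bridgeless cycleEdges
  bridgeless a b _ ab∈ with edge-position ab∈
  ... | e , e<n , ab≐e = connected-avoiding e λ c<n c≢e →
    adjIn-remove⁺ cycleEdges a b (cycle-adjIn c<n)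
      (c≢e ∘ cycle-edge-unique c<n e<n ∘ λ c≐ab → ≐-trans c≐ab ab≐e)

  size≤n : size cycleEdges ≤ n
  size≤n = successorEdges⇒size≤n successor cycleEdges (λ _ _ _ → cycleEdges-cases)

  yesInstance : YesInstance (allEdgesUnsafeInstance G)
  yesInstance =
    cycleEdges ,
    ((λ _ _ _ → inj₂ ∘ cycleEdges⊆G) , connected , λ u v u<v uv∈ _ → bridgeless u v u<v uv∈) ,
    size≤n

-- From an unsafe spanning connected subgraph to a Hamiltonian cycle

TwoNeighbours : EdgeSet n → Fin n → Set
TwoNeighbours X v = ∃₂ λ a b → a ≢ b × AdjIn X v a × AdjIn X v b

AtMostTwoNeighbours : EdgeSet n → Set
AtMostTwoNeighbours X = ∀ {v a b c} → AdjIn X v a → AdjIn X v b → AdjIn X v c → a ≡ b ⊎ a ≡ c ⊎ b ≡ c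

another-vertex : 2 ≤ n → (v : Fin n) → ∃ λ w → v ≢ w
another-vertex (s≤s (s≤s _)) Fin.zero = Fin.suc Fin.zero , λ ()
another-vertex (s≤s (s≤s _)) (Fin.suc _) = Fin.zero , λ ()

module _ {X : EdgeSet n} where

  bridgeless-drop : Bridgeless X → ∀ {u v} → AdjIn X u v →
    ∃ λ Y → Connected Y × (∀ {p q} → AdjIn Y p q → AdjIn X p q) × ¬ AdjIn Y u v
  bridgeless-drop bridgeless {u} {v} (inj₁ (u<v , uv∈)) =
    remove X u v , bridgeless u v u<v uv∈ , adjIn-remove⁻ X u v , remove-removes X u v u<v
  bridgeless-drop bridgeless {u} {v} (inj₂ (v<u , vu∈)) =
    remove X v u , bridgeless v u v<u vu∈ , adjIn-remove⁻ X v u ,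
    remove-removes X v u v<u ∘ adjIn-sym {X = remove X v u}

  bridgeless⇒twoNeighbours : 2 ≤ n → Connected X → Bridgeless X → ∀ v → TwoNeighbours X v
  bridgeless⇒twoNeighbours 2≤n connected bridgeless v with another-vertex 2≤n v
  ... | w , v≢w with first-step v≢w (connected v w)
  ... | a , va with bridgeless-drop bridgeless va
  ... | Y , Y-connected , Y⊆X , ¬va with first-step (adjIn-irrefl {X = X} va) (Y-connected v a)
  ... | b , vb = a , b , (λ { refl → ¬va vb }) , va , Y⊆X vb

  twoNeighbours⇒2≤degree : ∀ {v} → TwoNeighbours X v → 2 ≤ degree X v
  twoNeighbours⇒2≤degree (a , b , a≢b , va , vb) = ℕₚ.≤-trans
    (ℕₚ.+-mono-≤ (adjIn⇒1≤edgeCount X va) (adjIn⇒1≤edgeCount X vb)) (fi+fj≤∑f _ a≢b)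

  degree≤2 : (∀ v → 2 ≤ degree X v) → size X ≤ n → ∀ v → degree X v ≤ 2
  degree≤2 2≤degree size≤n = ∑≤n*k⇒f≤k (degree X) 2≤degree (begin
    ∑[ v < n ] degree X v  ≡⟨ handshake X ⟩
    size X + size X        ≤⟨ ℕₚ.+-mono-≤ size≤n size≤n ⟩
    n + n                  ≡⟨ cong (n +_) (ℕₚ.+-identityʳ n) ⟨
    2 * n                  ≡⟨ ℕₚ.*-comm 2 n ⟩
    n * 2                  ∎)
    where open ℕₚ.≤-Reasoning

  degree≤2⇒atMostTwoNeighbours : (∀ v → degree X v ≤ 2) → AtMostTwoNeighbours X
  degree≤2⇒atMostTwoNeighbours degree≤2 {v} {a} {b} {c} va vb vc with a Finₚ.≟ b | a Finₚ.≟ c | b Finₚ.≟ c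
  ... | yes a≡b | _       | _       = inj₁ a≡b
  ... | no _    | yes a≡c | _       = inj₂ (inj₁ a≡c)
  ... | no _    | no _    | yes b≡c = inj₂ (inj₂ b≡c)
  ... | no a≢b  | no a≢c  | no b≢c  = ⊥-elim (ℕₚ.<-irrefl refl (ℕₚ.≤-trans 3≤degree (degree≤2 v)))
    where
    3≤degree : 3 ≤ degree X v
    3≤degree = ℕₚ.≤-trans
      (ℕₚ.+-mono-≤ (adjIn⇒1≤edgeCount X va)
        (ℕₚ.+-mono-≤ (adjIn⇒1≤edgeCount X vb) (adjIn⇒1≤edgeCount X vc)))
      (fi+fj+fk≤∑f _ a≢b a≢c b≢c)

module TwoRegularWalk {X : EdgeSet n} (connected : Connected X) (twoNeighbours : ∀ v → TwoNeighbours X v)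
  (atMostTwo : AtMostTwoNeighbours X) (start : Fin n) where

  neighbourOtherThan : ∀ v p → ∃ λ y → AdjIn X v y × y ≢ p
  neighbourOtherThan v p with twoNeighbours v
  ... | a , b , a≢b , va , vb with a Finₚ.≟ p
  ...   | yes refl = b , vb , a≢b ∘ sym
  ...   | no a≢p = a , va , a≢p

  turn : Fin n × Fin n → Fin n × Fin n
  turn (previous , current) = current , proj₁ (neighbourOtherThan current previous)

  trail : ℕ → Fin n × Fin n
  trail zero = start , proj₁ (neighbourOtherThan start start)
  trail (suc i) = turn (trail i)

  x : ℕ → Fin n
  x = proj₁ ∘ trail

  x-adjacent : ∀ i → AdjIn X (x i) (x (suc i))
  x-adjacent zero = proj₁ (proj₂ (neighbourOtherThan start start))
  x-adjacent (suc i) = proj₁ (proj₂ (neighbourOtherThan (x (suc i)) (x i)))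

  x-no-backtrack : ∀ i → x (suc (suc i)) ≢ x i
  x-no-backtrack i = proj₂ (proj₂ (neighbourOtherThan (x (suc i)) (x i)))

  injectiveBelow-extend : ∀ {k} → InjectiveBelow x k → (∀ {j} → j < k → x k ≢ x j) → InjectiveBelow x (suc k)
  injectiveBelow-extend injective fresh a<1+k b<1+k xa≡xb
    with ℕₚ.m≤n⇒m<n∨m≡n (ℕₚ.≤-pred a<1+k) | ℕₚ.m≤n⇒m<n∨m≡n (ℕₚ.≤-pred b<1+k)
  ... | inj₁ a<k  | inj₁ b<k  = injective a<k b<k xa≡xb
  ... | inj₁ a<k  | inj₂ refl = ⊥-elim (fresh a<k (sym xa≡xb))
  ... | inj₂ refl | inj₁ b<k  = ⊥-elim (fresh b<k xa≡xb)
  ... | inj₂ refl | inj₂ refl = refl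

  -- Any other vertex x j of the trail already has the two neighbours x (j - 1) and x (j + 1).
  revisit⇒start : ∀ {k j} → InjectiveBelow x k → j < k → x k ≡ x j → j ≡ 0
  revisit⇒start {j = zero} _ _ _ = refl
  revisit⇒start {zero} {suc j} _ () _
  revisit⇒start {suc m} {suc j} injective 1+j<1+m xk≡xj with ℕₚ.m≤n⇒m<n∨m≡n (ℕₚ.≤-pred 1+j<1+m)
  ... | inj₂ refl = ⊥-elim (adjIn-irrefl {X = X} (x-adjacent (suc j)) (sym xk≡xj))
  ... | inj₁ 1+j<m
    with atMostTwo (adjIn-sym {X = X} (x-adjacent j)) (x-adjacent (suc j))
                   (subst (λ y → AdjIn X y (x m)) xk≡xj (adjIn-sym {X = X} (x-adjacent m)))
  ...   | inj₁ xj≡x2+j =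
    ⊥-elim (ℕₚ.<⇒≢ (ℕₚ.m<n⇒m<1+n (ℕₚ.n<1+n j)) (injective j<1+m (s≤s 1+j<m) xj≡x2+j))
    where j<1+m = ℕₚ.<-trans (ℕₚ.n<1+n j) 1+j<1+m
  ...   | inj₂ (inj₁ xj≡xm) =
    ⊥-elim (ℕₚ.<⇒≢ j<m (injective (ℕₚ.m<n⇒m<1+n j<m) (ℕₚ.n<1+n m) xj≡xm))
    where j<m = ℕₚ.<-trans (ℕₚ.n<1+n j) 1+j<m
  ...   | inj₂ (inj₂ x2+j≡xm) with injective (s≤s 1+j<m) (ℕₚ.n<1+n m) x2+j≡xm
  ...     | refl = ⊥-elim (x-no-backtrack (suc j) xk≡xj)

  closing⇒2≤length : ∀ {m} → x (suc m) ≡ x 0 → 2 ≤ m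
  closing⇒2≤length {zero} x1≡x0 = ⊥-elim (adjIn-irrefl {X = X} (x-adjacent 0) (sym x1≡x0))
  closing⇒2≤length {suc zero} x2≡x0 = ⊥-elim (x-no-backtrack 0 x2≡x0)
  closing⇒2≤length {suc (suc m)} _ = s≤s (s≤s z≤n)

  -- A closed trail is closed under taking neighbours, so by connectedness it visits every vertex.
  closing⇒n≤length : ∀ {m} → InjectiveBelow x (suc m) → x (suc m) ≡ x 0 → n ≤ suc m
  closing⇒n≤length {m} injective closes = Finₚ.injective⇒≤ index-injective
    where
    OnTrail : Fin n → Set
    OnTrail w = ∃ λ k → k ≤ m × x k ≡ w

    successor-on-trail : ∀ {k} → k ≤ m → OnTrail (x (suc k))
    successor-on-trail {k} k≤m with ℕₚ.m≤n⇒m<n∨m≡n k≤m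
    ... | inj₁ k<m  = suc k , k<m , refl
    ... | inj₂ refl = 0 , z≤n , sym closes

    neighbour-on-trail : ∀ {k y} → k ≤ m → AdjIn X (x k) y → OnTrail y
    neighbour-on-trail {zero} {y} _ x0y
      with atMostTwo x0y (x-adjacent 0) (adjIn-sym {X = X} (subst (AdjIn X (x m)) closes (x-adjacent m)))
    ... | inj₁ refl = successor-on-trail z≤n
    ... | inj₂ (inj₁ refl) = m , ℕₚ.≤-refl , refl
    ... | inj₂ (inj₂ x1≡xm) = ⊥-elim (ℕₚ.<⇒≢ 1<m (injective (s≤s (ℕₚ.<⇒≤ 1<m)) (ℕₚ.n<1+n m) x1≡xm))
      where 1<m = closing⇒2≤length closes
    neighbour-on-trail {suc k} {y} 1+k≤m xy
      with atMostTwo xy (x-adjacent (suc k)) (adjIn-sym {X = X} (x-adjacent k))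
    ... | inj₁ refl = successor-on-trail 1+k≤m
    ... | inj₂ (inj₁ refl) = k , ℕₚ.<⇒≤ 1+k≤m , refl
    ... | inj₂ (inj₂ x2+k≡xk) = ⊥-elim (x-no-backtrack k x2+k≡xk)

    on-trail : ∀ w → OnTrail w
    on-trail = connected-invariant connected OnTrail
      (λ { xy (k , k≤m , refl) → neighbour-on-trail k≤m xy }) (0 , z≤n , refl)

    index : Fin n → Fin (suc m)
    index w = fromℕ< (s≤s (proj₁ (proj₂ (on-trail w))))

    index-injective : Injective _≡_ _≡_ index
    index-injective {w} {w′} same-index with on-trail w | on-trail w′
    ... | k , _ , refl | k′ , _ , refl =
      cong x (trans (sym (Finₚ.toℕ-fromℕ< _)) (trans (cong toℕ same-index) (Finₚ.toℕ-fromℕ< _)))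

  x-fresh : ∀ {k} → k < n → InjectiveBelow x k → ∀ {j} → j < k → x k ≢ x j
  x-fresh {zero} _ _ ()
  x-fresh {suc m} 1+m<n injective j<k xk≡xj with revisit⇒start injective j<k xk≡xj
  ... | refl = ℕₚ.<⇒≱ 1+m<n (closing⇒n≤length injective xk≡xj)

  injectiveBelow : ∀ {k} → k ≤ n → InjectiveBelow x k
  injectiveBelow {zero} _ ()
  injectiveBelow {suc k} k<n = injectiveBelow-extend injective (x-fresh k<n injective)
    where injective = injectiveBelow (ℕₚ.<⇒≤ k<n)

  closes : x n ≡ x 0
  closes with injectiveBelow⇒surjective (injectiveBelow ℕₚ.≤-refl) (x n)
  ... | j , j<n , xj≡xn =
    trans (sym xj≡xn) (cong x (revisit⇒start (injectiveBelow ℕₚ.≤-refl) j<n (sym xj≡xn)))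

  closedWalk : HamiltonianClosedWalk (AdjIn X)
  closedWalk = record
    { vertex   = x
    ; adjacent = λ {c} _ → x-adjacent c
    ; distinct = injectiveBelow ℕₚ.≤-refl
    ; closed   = closes
    }

yes⇒closedWalk : 3 ≤ n → (G : Graph n) → YesInstance (allEdgesUnsafeInstance G) → HamiltonianClosedWalk (Adj G)
yes⇒closedWalk {zero} () _ _
yes⇒closedWalk {suc n} 3≤n G (X , (X⊆G , connected , removable) , size≤n) =
  mapClosedWalk adjIn⇒adj (TwoRegularWalk.closedWalk connected twoNeighbours atMostTwo Fin.zero)
  where
  in-G : ∀ {u v} → u Fin.< v → T (X u v) → Adj G u v
  in-G {u} {v} u<v uv∈ with X⊆G u v u<v uv∈
  ... | inj₂ uv∈G = uv∈G

  adjIn⇒adj : ∀ {u v} → AdjIn X u v → Adj G u v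
  adjIn⇒adj (inj₁ (u<v , uv∈)) = in-G u<v uv∈
  adjIn⇒adj (inj₂ (v<u , vu∈)) = subst T (adj-sym G _ _) (in-G v<u vu∈)

  bridgeless : Bridgeless X
  bridgeless u v u<v uv∈ = removable u v u<v uv∈ (in-G u<v uv∈)

  twoNeighbours : ∀ v → TwoNeighbours X v
  twoNeighbours = bridgeless⇒twoNeighbours (ℕₚ.<⇒≤ 3≤n) connected bridgeless

  atMostTwo : AtMostTwoNeighbours X
  atMostTwo = degree≤2⇒atMostTwoNeighbours {X = X}
    (degree≤2 (twoNeighbours⇒2≤degree {X = X} ∘ twoNeighbours) size≤n)

mainTheorem5 : (n : ℕ) → 3 ≤ n → (G : Graph n) →
    HamiltonianCycle G ⇔ YesInstance (allEdgesUnsafeInstance G)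
mainTheorem5 zero () _
mainTheorem5 (suc n) 3≤n G =
  mk⇔ (CycleEdges.yesInstance 3≤n G) (yes⇒closedWalk 3≤n G) ⇔-∘ cycle⇔closedWalk G
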